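{- If $G\in\mathcal{E}$ and $v\in V(G)$ with $d_G(v)\le 2$, then $\iota(G-v,P_3)\le (|V(G)|-3)/4$, and if $G\notin\{P_3,C_3\}$, then $G-v$ is connected.
   Context: All graphs are finite and simple. For $D\subseteq V(G)$, $N[D]$ denotes the closed neighbourhood of $D$. A set $D\subseteq V(G)$ is a $P_3$-isolating set of $G$ if $G-N[D]$ contains no copy of the $3$-vertex path $P_3$; $\iota(G,P_3)$ is the minimum size of such a set. $G-v$ is the graph obtained by deleting $v$. The family $\mathcal{E}$ consists of the following $12$ graphs: $P_3$, $C_3$, $C_7$, $C_{11}$, and $G_{7,1}$ on $[7]$ with edges $17,27,67,23,34,35,45,56$; $G_{7,2}$ on $[7]$ with edges $17,27,67,12,23,34,35,45,56$; $G_{7,3}$ on $[7]$ with edges $17,27,67,23,34,35,45,56,14$; $G_{7,4}$ on $[7]$ with edges $17,27,67,12,23,34,35,45,56,14$; $G_{7,5}$ on $[7]$ with edges $12,17,23,27,34,35,46,56,67$; $G_{7,6}$ on $[7]$ with edges $12,17,23,27,34,35,45,46,56,67$; $G_{11}$ on $[11]$ with edges $\{1,2\},\{1,11\},\{2,11\},\{2,3\},\{3,4\},\{3,9\},\{4,5\},\{4,10\},\{5,6\},\{6,7\},\{7,8\},\{8,9\},\{9,10\},\{10,11\}$; $G_{15}$ on $[15]$ with edges $\{1,2\},\{1,15\},\{2,15\},\{2,3\},\{3,4\},\{3,13\},\{4,5\},\{4,14\},\{5,6\},\{6,7\},\{6,11\},\{7,8\},\{7,12\},\{8,9\},\{8,10\},\{9,10\},\{10,11\},\{11,12\},\{12,13\},\{13,14\},\{14,15\}$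 (here $ij$ denotes the edge $\{i,j\}$). -}

module Defs where

open import Data.Nat using (ℕ; zero; suc; _+_; _≡ᵇ_)
open import Data.Bool using (Bool; true; false; _∧_; _∨_; if_then_else_)
open import Data.Fin using (Fin; toℕ; punchIn)
open import Data.Fin.Subset using (Subset; _∈_)
open import Data.List using (List; []; _∷_; map; allFin)
open import Data.Nat.ListAction using (sum)
open import Data.Bool.ListAction using (any)
open import Data.Bool.Properties using (∨-comm)
open import Data.Bool using (not; T)
open import Data.Fin.Properties using (all?)
open import Relation.Nullary.Decidable using (toWitness)
open import Relation.Binary.PropositionalEquality using (cong; cong₂; refl)
open import Data.Product using (_×_; _,_; ∃-syntax)
open import Data.Sum using (_⊎_)
open import Relation.Binary.PropositionalEquality using (_≡_; _≢_)
open import Data.Empty using (⊥)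
open import Relation.Nullary using (¬_)

record Graph (n : ℕ) : Set where
  field
    adj     : Fin n → Fin n → Bool
    adj-sym : ∀ x y → adj x y ≡ adj y x
    adj-irr : ∀ x → adj x x ≡ false
open Graph public

deg : ∀ {n} → Graph n → Fin n → ℕ
deg {n} G v = sum (map (λ u → if adj G v u then 1 else 0) (allFin n))

_-ᵥ_ : ∀ {m} → Graph (suc m) → Fin (suc m) → Graph m
G -ᵥ v = record
  { adj     = λ x y → adj G (punchIn v x) (punchIn v y)
  ; adj-sym = λ x y → adj-sym G (punchIn v x) (punchIn v y)
  ; adj-irr = λ x → adj-irr G (punchIn v x)
  }

InClosedNbhd : ∀ {n} → Graph n → Subset n → Fin n → Set
InClosedNbhd G D x = x ∈ D ⊎ ∃[ d ] (d ∈ D × adj G d x ≡ true)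

-- D is P3-isolating: G - N[D] contains no (not necessarily induced) path a-b-c
IsP3Isolating : ∀ {n} → Graph n → Subset n → Set
IsP3Isolating G D =
  ∀ a b c → ¬ InClosedNbhd G D a → ¬ InClosedNbhd G D b → ¬ InClosedNbhd G D c →
  a ≢ c → adj G a b ≡ true → adj G b c ≡ true → ⊥

data Reach {n} (G : Graph n) : Fin n → Fin n → Set where
  here : ∀ {x} → Reach G x x
  step : ∀ {x y z} → adj G x y ≡ true → Reach G y z → Reach G x z

Connected : ∀ {n} → Graph n → Set
Connected {n} G = ∀ (x y : Fin n) → Reach G x y

-- Graphs from explicit edge lists (vertices labelled 1..n)

edgeAdj : ∀ {n} → List (ℕ × ℕ) → Fin n → Fin n → Bool
edgeAdj es x y = any (λ { (a , b) →
    ((suc (toℕ x) ≡ᵇ a) ∧ (suc (toℕ y) ≡ᵇ b)) ∨ ((suc (toℕ y) ≡ᵇ a) ∧ (suc (toℕ x) ≡ᵇ b)) }) es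

data Fam : Set where
  P3 C3 C7 C11 G71 G72 G73 G74 G75 G76 G11 G15 : Fam

-- |V(G)| - 1
famPred : Fam → ℕ
famPred P3  = 2
famPred C3  = 2
famPred C7  = 6
famPred C11 = 10
famPred G71 = 6
famPred G72 = 6
famPred G73 = 6
famPred G74 = 6
famPred G75 = 6
famPred G76 = 6
famPred G11 = 10
famPred G15 = 14

famEdges : Fam → List (ℕ × ℕ)
famEdges P3  = (1 , 2) ∷ (2 , 3) ∷ []
famEdges C3  = (1 , 2) ∷ (2 , 3) ∷ (3 , 1) ∷ []
famEdges C7  = (1 , 2) ∷ (2 , 3) ∷ (3 , 4) ∷ (4 , 5) ∷ (5 , 6) ∷ (6 , 7) ∷ (7 , 1) ∷ []
famEdges C11 = (1 , 2) ∷ (2 , 3) ∷ (3 , 4) ∷ (4 , 5) ∷ (5 , 6) ∷ (6 , 7) ∷ (7 , 8) ∷ (8 , 9)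
             ∷ (9 , 10) ∷ (10 , 11) ∷ (11 , 1) ∷ []
famEdges G71 = (1 , 7) ∷ (2 , 7) ∷ (6 , 7) ∷ (2 , 3) ∷ (3 , 4) ∷ (3 , 5) ∷ (4 , 5) ∷ (5 , 6) ∷ []
famEdges G72 = (1 , 7) ∷ (2 , 7) ∷ (6 , 7) ∷ (1 , 2) ∷ (2 , 3) ∷ (3 , 4) ∷ (3 , 5) ∷ (4 , 5) ∷ (5 , 6) ∷ []
famEdges G73 = (1 , 7) ∷ (2 , 7) ∷ (6 , 7) ∷ (2 , 3) ∷ (3 , 4) ∷ (3 , 5) ∷ (4 , 5) ∷ (5 , 6) ∷ (1 , 4) ∷ []
famEdges G74 = (1 , 7) ∷ (2 , 7) ∷ (6 , 7) ∷ (1 , 2) ∷ (2 , 3) ∷ (3 , 4) ∷ (3 , 5) ∷ (4 , 5) ∷ (5 , 6) ∷ (1 , 4) ∷ []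
famEdges G75 = (1 , 2) ∷ (1 , 7) ∷ (2 , 3) ∷ (2 , 7) ∷ (3 , 4) ∷ (3 , 5) ∷ (4 , 6) ∷ (5 , 6) ∷ (6 , 7) ∷ []
famEdges G76 = (1 , 2) ∷ (1 , 7) ∷ (2 , 3) ∷ (2 , 7) ∷ (3 , 4) ∷ (3 , 5) ∷ (4 , 5) ∷ (4 , 6) ∷ (5 , 6) ∷ (6 , 7) ∷ []
famEdges G11 = (1 , 2) ∷ (1 , 11) ∷ (2 , 11) ∷ (2 , 3) ∷ (3 , 4) ∷ (3 , 9) ∷ (4 , 5) ∷ (4 , 10)
             ∷ (5 , 6) ∷ (6 , 7) ∷ (7 , 8) ∷ (8 , 9) ∷ (9 , 10) ∷ (10 , 11) ∷ []
famEdges G15 = (1 , 2) ∷ (1 , 15) ∷ (2 , 15) ∷ (2 , 3) ∷ (3 , 4) ∷ (3 , 13) ∷ (4 , 5) ∷ (4 , 14)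
             ∷ (5 , 6) ∷ (6 , 7) ∷ (6 , 11) ∷ (7 , 8) ∷ (7 , 12) ∷ (8 , 9) ∷ (8 , 10) ∷ (9 , 10)
             ∷ (10 , 11) ∷ (11 , 12) ∷ (12 , 13) ∷ (13 , 14) ∷ (14 , 15) ∷ []

edgeAdj-sym : ∀ {n} (es : List (ℕ × ℕ)) (x y : Fin n) → edgeAdj es x y ≡ edgeAdj es y x
edgeAdj-sym [] x y = refl
edgeAdj-sym ((a , b) ∷ es) x y =
  cong₂ _∨_ (∨-comm ((suc (toℕ x) ≡ᵇ a) ∧ (suc (toℕ y) ≡ᵇ b)) ((suc (toℕ y) ≡ᵇ a) ∧ (suc (toℕ x) ≡ᵇ b)))
            (edgeAdj-sym es x y)

loopFree? : ∀ {n} (es : List (ℕ × ℕ)) → _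
loopFree? {n} es = all? {n = n} (λ x → Data.Bool._≟_ (edgeAdj es x x) false)
  where import Data.Bool

famIrr : (i : Fam) (x : Fin (suc (famPred i))) → edgeAdj (famEdges i) x x ≡ false
famIrr i = toWitness {a? = loopFree? {suc (famPred i)} (famEdges i)} (lem i)
  where
  lem : (i : Fam) → T (Relation.Nullary.Decidable.isYes (loopFree? {suc (famPred i)} (famEdges i)))
  lem P3 = _
  lem C3 = _
  lem C7 = _
  lem C11 = _
  lem G71 = _
  lem G72 = _
  lem G73 = _
  lem G74 = _
  lem G75 = _
  lem G76 = _
  lem G11 = _
  lem G15 = _

famGraph : (i : Fam) → Graph (suc (famPred i))
famGraph i = record
  { adj = edgeAdj (famEdges i)
  ; adj-sym = edgeAdj-sym (famEdges i)
  ; adj-irr = famIrr i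
  }

{-# OPTIONS --safe #-}
-- Every graph of 𝓔 is a fixed small graph, so the lemma is a finite check carried out by
-- evaluation.  For each vertex v of degree at most 2, one of a few explicit candidate sets
-- is verified to be a P₃-isolating set of G - v of size at most (|V(G)| - 3)/4, and G - v
-- is shown connected by computing the set of vertices joined to a root by a walk of length
-- at most |V(G - v)|, iterating closed neighbourhoods.
module Submission where

open import Defs
open import Data.Nat using (ℕ; zero; suc; _+_; _*_; _≤_; _≤?_)
open import Data.Fin using (Fin; toℕ)
open import Data.Fin.Subset using (Subset; ∣_∣; _∈_; ⁅_⁆)
open import Data.Product using (_×_; ∃-syntax; _,_; proj₁; proj₂)
open import Relation.Binary.PropositionalEquality using (_≢_; _≡_; refl; sym; trans)

open import Level using (Level)
open import Data.Bool using (true)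
open import Data.Bool.Properties using (T-≡) renaming (_≟_ to _≟ᵇ_)
open import Data.Fin.Properties using (any?; all?; _≟_)
open import Data.Fin.Subset.Properties using (_∈?_; x∈⁅y⁆⇒x≡y)
open import Data.List using (List; []; _∷_; map)
open import Data.List.Membership.DecPropositional Data.Nat._≟_ using () renaming (_∈?_ to _∈ˡ?_)
open import Data.List.Relation.Unary.Any as Any using (Any)
open import Data.Sum using (inj₁; inj₂)
open import Data.Vec using (tabulate; removeAt)
open import Data.Vec.Properties using (lookup∘tabulate; []=⇒lookup)
open import Function using (_∘_; Equivalence)
open import Relation.Nullary using (contradiction)
open import Relation.Nullary.Decidable
  using (Dec; no; isYes; ¬?; _⊎-dec_; _×-dec_; _→-dec_; True; toWitness)
open import Relation.Unary using (Pred; Decidable)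

private variable
  ℓ : Level
  n : ℕ

decSubset : {P : Pred (Fin n) ℓ} → Decidable P → Subset n
decSubset P? = tabulate (isYes ∘ P?)

∈-decSubset⁻ : {P : Pred (Fin n) ℓ} (P? : Decidable P) {x : Fin n} → x ∈ decSubset P? → P x
∈-decSubset⁻ P? {x} x∈ =
  toWitness {a? = P? x} (Equivalence.from T-≡ (trans (sym (lookup∘tabulate (isYes ∘ P?) x)) ([]=⇒lookup x∈)))

module _ (G : Graph n) where

  adj? : ∀ x y → Dec (adj G x y ≡ true)
  adj? x y = adj G x y ≟ᵇ true

  inClosedNbhd? : (D : Subset n) → Decidable (InClosedNbhd G D)
  inClosedNbhd? D x = x ∈? D ⊎-dec any? λ d → d ∈? D ×-dec adj? d x

  isP3Isolating? : Decidable (IsP3Isolating G)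
  isP3Isolating? D = all? λ a → all? λ b → all? λ c →
    ¬? (N? a) →-dec ¬? (N? b) →-dec ¬? (N? c) →-dec ¬? (a ≟ c) →-dec adj? a b →-dec adj? b c →-dec no λ ()
    where N? = inClosedNbhd? D

  reach-trans : ∀ {x y z} → Reach G x y → Reach G y z → Reach G x z
  reach-trans here       q = q
  reach-trans (step e p) q = step e (reach-trans p q)

  reach-sym : ∀ {x y} → Reach G x y → Reach G y x
  reach-sym here               = here
  reach-sym (step {x} {y} e p) = reach-trans (reach-sym p) (step (trans (adj-sym G y x) e) here)

  reachingWithin : ℕ → Fin n → Subset n
  reachingWithin zero    r = ⁅ r ⁆
  reachingWithin (suc k) r = decSubset (inClosedNbhd? (reachingWithin k r))

  reachingWithin⇒Reach : ∀ k {r x} → x ∈ reachingWithin k r → Reach G x r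
  reachingWithin⇒Reach zero    {r} x∈ with refl ← x∈⁅y⁆⇒x≡y r x∈ = here
  reachingWithin⇒Reach (suc k) {r} {x} x∈ with ∈-decSubset⁻ (inClosedNbhd? (reachingWithin k r)) x∈
  ... | inj₁ x∈S           = reachingWithin⇒Reach k x∈S
  ... | inj₂ (y , y∈S , e) = step (trans (adj-sym G x y) e) (reachingWithin⇒Reach k y∈S)

  ReachedByAll : Fin n → Set
  ReachedByAll r = ∀ x → x ∈ reachingWithin n r

  reachedByAll? : Decidable ReachedByAll
  reachedByAll? r = all? λ x → x ∈? reachingWithin n r

  reachedByAll⇒connected : ∀ r → ReachedByAll r → Connected G
  reachedByAll⇒connected r reached x y =
    reach-trans (reachingWithin⇒Reach n (reached x)) (reach-sym (reachingWithin⇒Reach n (reached y)))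

SmallP3Isolating : Graph n → Subset n → Set
SmallP3Isolating {n} G D = IsP3Isolating G D × 4 * ∣ D ∣ + 3 ≤ suc n

smallP3Isolating? : (G : Graph n) → Decidable (SmallP3Isolating G)
smallP3Isolating? {n} G D = isP3Isolating? G D ×-dec 4 * ∣ D ∣ + 3 ≤? suc n

fromLabels : List ℕ → Subset n
fromLabels ls = decSubset λ x → suc (toℕ x) ∈ˡ? ls

-- Sets of vertices of G, labelled 1, 2, … as in the edge lists; for every v of degree at
-- most 2, one of them, with v removed, isolates G - v.
isolatorCandidates : Fam → List (List ℕ)
isolatorCandidates P3  = [] ∷ []
isolatorCandidates C3  = [] ∷ []
isolatorCandidates C7  = (1 ∷ []) ∷ (3 ∷ []) ∷ (5 ∷ []) ∷ (6 ∷ []) ∷ []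
isolatorCandidates C11 = (1 ∷ 6 ∷ []) ∷ (1 ∷ 7 ∷ []) ∷ (4 ∷ 9 ∷ []) ∷ (3 ∷ 9 ∷ []) ∷ []
isolatorCandidates G71 = (2 ∷ []) ∷ (5 ∷ []) ∷ []
isolatorCandidates G72 = (2 ∷ []) ∷ (3 ∷ []) ∷ []
isolatorCandidates G73 = (3 ∷ []) ∷ (4 ∷ []) ∷ []
isolatorCandidates G74 = (1 ∷ []) ∷ []
isolatorCandidates G75 = (2 ∷ []) ∷ (3 ∷ []) ∷ []
isolatorCandidates G76 = (3 ∷ []) ∷ []
isolatorCandidates G11 = (3 ∷ 4 ∷ []) ∷ (1 ∷ 9 ∷ []) ∷ (3 ∷ 5 ∷ []) ∷ []
isolatorCandidates G15 = (1 ∷ 3 ∷ 6 ∷ []) ∷ (1 ∷ 8 ∷ 13 ∷ []) ∷ (3 ∷ 5 ∷ 8 ∷ []) ∷ []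

module _ (i : Fam) where

  LowDegree : Fin (suc (famPred i)) → Set
  LowDegree v = deg (famGraph i) v ≤ 2

  isolatorsAfterDeleting : Fin (suc (famPred i)) → List (Subset (famPred i))
  isolatorsAfterDeleting v = map (λ ls → removeAt (fromLabels ls) v) (isolatorCandidates i)

  IsolableAtLowDegree : Set
  IsolableAtLowDegree =
    ∀ v → LowDegree v → Any (SmallP3Isolating (famGraph i -ᵥ v)) (isolatorsAfterDeleting v)

  isolableAtLowDegree? : Dec IsolableAtLowDegree
  isolableAtLowDegree? = all? λ v →
    deg (famGraph i) v ≤? 2 →-dec Any.any? (smallP3Isolating? (famGraph i -ᵥ v)) (isolatorsAfterDeleting v)

  ConnectedAtLowDegree : Set
  ConnectedAtLowDegree = ∀ v → LowDegree v → ∃[ r ] ReachedByAll (famGraph i -ᵥ v) r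

  connectedAtLowDegree? : Dec ConnectedAtLowDegree
  connectedAtLowDegree? = all? λ v → deg (famGraph i) v ≤? 2 →-dec any? (reachedByAll? (famGraph i -ᵥ v))

-- Deleting any vertex of C₃ leaves an edge, so only P₃ is excluded here.
verified : ∀ i → True (isolableAtLowDegree? i) × (i ≢ P3 → True (connectedAtLowDegree? i))
verified P3  = _ , λ i≢P3 → contradiction refl i≢P3
verified C3  = _ , _
verified C7  = _ , _
verified C11 = _ , _
verified G71 = _ , _
verified G72 = _ , _
verified G73 = _ , _
verified G74 = _ , _
verified G75 = _ , _
verified G76 = _ , _
verified G11 = _ , _
verified G15 = _ , _

lemma2p10 : (i : Fam) (v : Fin (suc (famPred i))) →
    deg (famGraph i) v ≤ 2 →
    (∃[ D ] (IsP3Isolating (famGraph i -ᵥ v) D × 4 * ∣ D ∣ + 3 ≤ suc (famPred i)))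
    × (i ≢ P3 → i ≢ C3 → Connected (famGraph i -ᵥ v))
lemma2p10 i v low = isolated , connected
  where
  isolated : ∃[ D ] SmallP3Isolating (famGraph i -ᵥ v) D
  isolated = Any.satisfied (toWitness (proj₁ (verified i)) v low)

  connected : i ≢ P3 → i ≢ C3 → Connected (famGraph i -ᵥ v)
  connected i≢P3 _ with r , reached ← toWitness (proj₂ (verified i) i≢P3) v low =
    reachedByAll⇒connected (famGraph i -ᵥ v) r reached
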